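{- Let $n\ge 1$ be an integer and let the edges of the complete graph $G=K_{4n}$ be coloured black and red. Let $M$ be a perfect matching of $G$. Let $V_B(M)$ be the set of vertices incident to a black edge of $M$ and $V_R(M)$ the set of vertices incident to a red edge of $M$, and let $E(V_R(M),V_B(M))$ be the set of edges of $G$ with one endpoint in $V_R(M)$ and the other in $V_B(M)$. For a perfect matching $M$ and vertices $u,v,x,y$, define the swapping $S(M,u,v,x,y)$ to be the perfect matching with edge set $(E(M)\cup\{ux,vy\})\setminus\{uv,xy\}$ if $uv\in M$ and $xy\in M$, and to be $M$ otherwise. Write $b(M)$ and $r(M)$ for the numbers of black and red edges of $M$. If $E(V_R(M),V_B(M))$ contains more red edges than black edges, then there exist vertices $u,v,x,y$ with $uv,xy\in M$ such that $M'=S(M,u,v,x,y)$ satisfies $r(M')=r(M)+1$ and $b(M')=b(M)-1$. In particular, if moreover $b(M)>r(M)$, then there is such a swapping with $|b(M')-r(M')|=|b(M)-r(M)|-2$.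
   Context: All matchings considered are perfect matchings. -}

module Defs where

open import Data.Nat using (ℕ; suc; zero)
open import Data.Bool using (Bool; true; false; _∧_; if_then_else_)
open import Data.Fin using (Fin; _≟_; _<?_)
open import Data.List using (List; allFin; cartesianProduct; filterᵇ; length)
open import Data.Product using (_×_; _,_)
open import Relation.Nullary using (¬_; yes; no)
open import Relation.Nullary.Decidable using (⌊_⌋)
open import Relation.Binary.PropositionalEquality using (_≡_)

data Colour : Set where
  black red : Colour

isRed : Colour → Bool
isRed red   = true
isRed black = false

isBlack : Colour → Bool
isBlack black = true
isBlack red   = false

-- A red/black edge colouring of the complete graph on vertex set Fin m:
-- a symmetric colour function (its values on the diagonal are irrelevant).
record Colouring (m : ℕ) : Set where
  field
    colour    : Fin m → Fin m → Colour
    symmetric : ∀ a b → colour a b ≡ colour b a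
open Colouring public

-- A perfect matching of K_m, given by its partner map: a fixed-point-free
-- involution. Its edges are the pairs {v , partner v}.
record PerfectMatching (m : ℕ) : Set where
  field
    partner     : Fin m → Fin m
    involutive  : ∀ v → partner (partner v) ≡ v
    fixpointFree : ∀ v → ¬ (partner v ≡ v)
open PerfectMatching public

count : ∀ {A : Set} → (A → Bool) → List A → ℕ
count P xs = length (filterᵇ P xs)

_∈M_ : ∀ {m} → (Fin m × Fin m) → (Fin m → Fin m) → Set
(u , v) ∈M p = p u ≡ v

-- Numbers of red / black edges of the matching with partner map p.
-- Each edge {w , p w} is counted once, via its endpoint w with w < p w.
rM : ∀ {m} → Colouring m → (Fin m → Fin m) → ℕ
rM {m} c p = count (λ w → ⌊ w <? p w ⌋ ∧ isRed (colour c w (p w))) (allFin m)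

bM : ∀ {m} → Colouring m → (Fin m → Fin m) → ℕ
bM {m} c p = count (λ w → ⌊ w <? p w ⌋ ∧ isBlack (colour c w (p w))) (allFin m)

inVR : ∀ {m} → Colouring m → PerfectMatching m → Fin m → Bool
inVR c M w = isRed (colour c w (partner M w))

inVB : ∀ {m} → Colouring m → PerfectMatching m → Fin m → Bool
inVB c M w = isBlack (colour c w (partner M w))

-- Numbers of red / black edges of E(V_R(M), V_B(M)).
-- V_R and V_B are disjoint, so each such edge is counted exactly once as an
-- ordered pair (a , b) with a ∈ V_R(M), b ∈ V_B(M).
redCross : ∀ {m} → Colouring m → PerfectMatching m → ℕ
redCross {m} c M = count (λ { (a , b) → inVR c M a ∧ inVB c M b ∧ isRed (colour c a b) })
                         (cartesianProduct (allFin m) (allFin m))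

blackCross : ∀ {m} → Colouring m → PerfectMatching m → ℕ
blackCross {m} c M = count (λ { (a , b) → inVR c M a ∧ inVB c M b ∧ isBlack (colour c a b) })
                           (cartesianProduct (allFin m) (allFin m))

swapMap : ∀ {m} → (Fin m → Fin m) → Fin m → Fin m → Fin m → Fin m → Fin m → Fin m
swapMap p u v x y w with p u ≟ v | p x ≟ y
... | yes _ | yes _ with w ≟ u | w ≟ v | w ≟ x | w ≟ y
...   | yes _ | _     | _     | _     = x
...   | no _  | yes _ | _     | _     = y
...   | no _  | no _  | yes _ | _     = u
...   | no _  | no _  | no _  | yes _ = v
...   | no _  | no _  | no _  | no _  = p w
swapMap p u v x y w | _ | _ = p w

S : ∀ {m} → PerfectMatching m → Fin m → Fin m → Fin m → Fin m → (Fin m → Fin m)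
S M u v x y = swapMap (partner M) u v x y

module Submission where

-- Counting every matching edge from both of its endpoints gives 2 r(M) = |V_R(M)| and
-- 2 b(M) = |V_B(M)|. Reindexing the black edges of E(V_R, V_B) by the involution
-- (a , b) ↦ (M a , M b) shows that, when red cross edges are in the majority, some a ∈ V_R
-- and b ∈ V_B have ab red while (M a)(M b) is not black, i.e. red as well. Swapping the red
-- edge a (M a) and the black edge b (M b) for ab and (M a)(M b) moves b and M b from V_B
-- to V_R, so r grows by one and b drops by one. Since r + b = 2n is even, r < b forces
-- r + 2 ≤ b, and |b − r| drops by exactly 2.

open import Defs
open import Data.Nat using (ℕ; _*_; _+_; _∸_; _<_; _≤_; _≤?_; ∣_-_∣; zero; suc; s≤s)
open import Data.Nat.Properties
  using ( +-assoc; +-identityʳ; +-cancelʳ-≡; +-mono-≤; *-assoc; *-cancelˡ-≡; *-distribˡ-+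
        ; <⇒≱; ≰⇒>; m≤n⇒∃[o]m+o≡n; even≢odd; ∣-∣-comm; ∣m-m+n∣≡n; +-0-commutativeMonoid )
open import Data.Fin using (Fin; _≟_; _<?_) renaming (zero to fzero; suc to fsuc)
open import Data.Fin.Properties as FP using (punchInᵢ≢i)
open import Data.Bool using (Bool; true; false; _∧_)
open import Data.List as List using (List; []; _∷_; _++_; tabulate; allFin; cartesianProduct)
open import Data.List.Properties using (map-cong-local)
open import Data.Nat.ListAction using () renaming (sum to listSum)
open import Data.List.Membership.Propositional using (_∉_)
open import Data.List.Relation.Unary.All as All using ([]; _∷_)
open import Data.List.Relation.Unary.Any using (here; there)
open import Data.List.Relation.Unary.AllPairs using ([]; _∷_)
open import Data.List.Relation.Unary.Unique.Propositional using (Unique)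
open import Data.Product using (_×_; _,_; ∃-syntax; proj₂)
open import Data.Vec.Functional using (removeAt; updateAt)
open import Data.Vec.Functional.Properties using (updateAt-updates; updateAt-minimal)
open import Data.Fin.Permutation using (permutation)
open import Function using (const; _∘_)
open import Data.Nat.Tactic.RingSolver using (solve-∀)
open import Relation.Nullary using (¬_; yes; no; contradiction)
open import Relation.Nullary.Decidable using (⌊_⌋; dec-yes; dec-no)
open import Relation.Binary.PropositionalEquality
open import Relation.Binary using (tri<; tri≈; tri>)
open import Algebra.Properties.CommutativeMonoid.Sum +-0-commutativeMonoid
  using (sum; sum-cong-≗; sum-remove; sum-permute; ∑-distrib-+)

fromBool : Bool → ℕ
fromBool true  = 1
fromBool false = 0

fromBool-isRed+isBlack : ∀ k → fromBool (isRed k) + fromBool (isBlack k) ≡ 1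
fromBool-isRed+isBlack red   = refl
fromBool-isRed+isBlack black = refl

count-++ : ∀ {A : Set} (P : A → Bool) xs ys → count P (xs ++ ys) ≡ count P xs + count P ys
count-++ P []       ys = refl
count-++ P (x ∷ xs) ys with P x
... | true  = cong suc (count-++ P xs ys)
... | false = count-++ P xs ys

count-map : ∀ {A B : Set} (P : B → Bool) (g : A → B) xs →
  count P (List.map g xs) ≡ count (λ x → P (g x)) xs
count-map P g []       = refl
count-map P g (x ∷ xs) with P (g x)
... | true  = cong suc (count-map P g xs)
... | false = count-map P g xs

count-tabulate : ∀ {A : Set} {m} (P : A → Bool) (f : Fin m → A) →
  count P (tabulate f) ≡ sum (λ i → fromBool (P (f i)))
count-tabulate {m = zero}  P f = refl
count-tabulate {m = suc m} P f with P (f fzero)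
... | true  = cong suc (count-tabulate P (λ i → f (fsuc i)))
... | false = count-tabulate P (λ i → f (fsuc i))

count-allFin : ∀ {m} (P : Fin m → Bool) → count P (allFin m) ≡ sum (λ i → fromBool (P i))
count-allFin P = count-tabulate P (λ i → i)

count-cartesianProduct : ∀ {A B : Set} {m} (P : A × B → Bool) (f : Fin m → A) (ys : List B) →
  count P (cartesianProduct (tabulate f) ys) ≡ sum (λ i → count (λ y → P (f i , y)) ys)
count-cartesianProduct {m = zero}  P f ys = refl
count-cartesianProduct {m = suc m} P f ys =
  trans (count-++ P (List.map (f fzero ,_) ys) _)
        (cong₂ _+_ (count-map P (f fzero ,_) ys) (count-cartesianProduct P (λ i → f (fsuc i)) ys))

count-allPairs : ∀ {m} (P : Fin m × Fin m → Bool) →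
  count P (cartesianProduct (allFin m) (allFin m)) ≡ sum (λ a → sum (λ b → fromBool (P (a , b))))
count-allPairs P =
  trans (count-cartesianProduct P (λ i → i) _) (sum-cong-≗ (λ a → count-allFin (λ b → P (a , b))))

sum-const-1 : ∀ m → sum {m} (const 1) ≡ m
sum-const-1 zero    = refl
sum-const-1 (suc m) = cong suc (sum-const-1 m)

sum-reindex-involution : ∀ {m} (p : Fin m → Fin m) → (∀ v → p (p v) ≡ v) →
  (f : Fin m → ℕ) → sum f ≡ sum (λ w → f (p w))
sum-reindex-involution p inv f = sum-permute f (permutation p p inv inv)

sum<sum⇒∃< : ∀ {m} (f g : Fin m → ℕ) → sum f < sum g → ∃[ i ] f i < g i
sum<sum⇒∃< {suc m} f g lt with g fzero ≤? f fzero | sum (λ i → g (fsuc i)) ≤? sum (λ i → f (fsuc i))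
... | yes g₀≤f₀ | yes gₛ≤fₛ = contradiction (+-mono-≤ g₀≤f₀ gₛ≤fₛ) (<⇒≱ lt)
... | no g₀≰f₀  | _          = fzero , ≰⇒> g₀≰f₀
... | yes _     | no gₛ≰fₛ   =
  let i , fᵢ<gᵢ = sum<sum⇒∃< (λ i → f (fsuc i)) (λ i → g (fsuc i)) (≰⇒> gₛ≰fₛ)
  in fsuc i , fᵢ<gᵢ

sum-updateAt : ∀ {m} (f : Fin m → ℕ) (a : Fin m) (z : ℕ) →
  sum f + z ≡ sum (updateAt f a (const z)) + f a
sum-updateAt {suc m} f a z = begin
  sum f + z                    ≡⟨ cong (_+ z) (sum-remove f) ⟩
  f a + sum (removeAt f a) + z ≡⟨ swap-outer (f a) _ z ⟩
  z + sum (removeAt f a) + f a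
    ≡⟨ cong₂ (λ x s → x + s + f a) (updateAt-updates a f) removeAt-h≡removeAt-f ⟨
  h a + sum (removeAt h a) + f a ≡⟨ cong (_+ f a) (sum-remove h) ⟨
  sum h + f a                  ∎
  where
  open ≡-Reasoning
  h : Fin (suc m) → ℕ
  h = updateAt f a (const z)
  removeAt-h≡removeAt-f : sum (removeAt h a) ≡ sum (removeAt f a)
  removeAt-h≡removeAt-f = sum-cong-≗ (λ j → updateAt-minimal _ a f (punchInᵢ≢i a j))
  swap-outer : ∀ x s y → x + s + y ≡ y + s + x
  swap-outer = solve-∀

sum-exchange-on : ∀ {m} (f g : Fin m → ℕ) {ds : List (Fin m)} → Unique ds →
  (∀ w → w ∉ ds → f w ≡ g w) →
  sum f + listSum (List.map g ds) ≡ sum g + listSum (List.map f ds)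
sum-exchange-on     f g {[]}     []              agree = cong (_+ 0) (sum-cong-≗ (λ w → agree w λ ()))
sum-exchange-on {m} f g {d ∷ ds} (d≢ds ∷ unique) agree = begin
  sum f + (g d + Σ g)   ≡⟨ +-assoc (sum f) (g d) (Σ g) ⟨
  sum f + g d + Σ g     ≡⟨ cong (_+ Σ g) (sum-updateAt f d (g d)) ⟩
  sum h + f d + Σ g     ≡⟨ rotate (sum h) (f d) (Σ g) ⟩
  f d + (sum h + Σ g)   ≡⟨ cong (f d +_) (sum-exchange-on h g unique h≡g-off-ds) ⟩
  f d + (sum g + Σ h)   ≡⟨ cong (λ s → f d + (sum g + s)) Σh≡Σf ⟩
  f d + (sum g + Σ f)   ≡⟨ rotate′ (f d) (sum g) (Σ f) ⟩
  sum g + (f d + Σ f)   ∎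
  where
  open ≡-Reasoning
  h : Fin m → ℕ
  h = updateAt f d (const (g d))
  Σ : (Fin m → ℕ) → ℕ
  Σ k = listSum (List.map k ds)
  h≡g-off-ds : ∀ w → w ∉ ds → h w ≡ g w
  h≡g-off-ds w w∉ds with w ≟ d
  ... | yes refl = updateAt-updates d f
  ... | no w≢d   = trans (updateAt-minimal w d f w≢d)
                         (agree w λ { (here w≡d) → w≢d w≡d ; (there w∈ds) → w∉ds w∈ds })
  Σh≡Σf : Σ h ≡ Σ f
  Σh≡Σf = cong listSum (map-cong-local (All.map (λ d≢w → updateAt-minimal _ d f (≢-sym d≢w)) d≢ds))
  rotate : ∀ x y z → x + y + z ≡ y + (x + z)
  rotate = solve-∀
  rotate′ : ∀ x y z → x + (y + z) ≡ y + (x + z)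
  rotate′ = solve-∀

fromBool-<-∧-split : ∀ {m} (s t : Fin m) (β : Bool) → s ≢ t →
  fromBool (⌊ s <? t ⌋ ∧ β) + fromBool (⌊ t <? s ⌋ ∧ β) ≡ fromBool β
fromBool-<-∧-split s t β s≢t with s <? t | t <? s
... | yes s<t | yes t<s = contradiction t<s (FP.<-asym s<t)
... | yes _   | no _    = +-identityʳ (fromBool β)
... | no _    | yes _   = refl
... | no s≮t  | no t≮s with FP.<-cmp s t
...   | tri< s<t _ _   = contradiction s<t s≮t
...   | tri≈ _ s≡t _   = contradiction s≡t s≢t
...   | tri> _ _ t<s   = contradiction t<s t≮s

colour-partner : ∀ {m} (c : Colouring m) (M : PerfectMatching m) (w : Fin m) →
  colour c (partner M w) (partner M (partner M w)) ≡ colour c w (partner M w)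
colour-partner c M w = trans (cong (colour c (partner M w)) (involutive M w)) (symmetric c (partner M w) w)

module _ {m} (c : Colouring m) (P : Colour → Bool) where

  edgesOfColour : (Fin m → Fin m) → ℕ
  edgesOfColour q = count (λ w → ⌊ w <? q w ⌋ ∧ P (colour c w (q w))) (allFin m)

  endpointsOfColour : (Fin m → Fin m) → ℕ
  endpointsOfColour q = sum (λ w → fromBool (P (colour c w (q w))))

  handshake : (M : PerfectMatching m) → 2 * edgesOfColour (partner M) ≡ endpointsOfColour (partner M)
  handshake M = begin
    2 * edgesOfColour p              ≡⟨ cong (2 *_) (count-allFin (λ w → ⌊ w <? p w ⌋ ∧ P (colour c w (p w)))) ⟩
    2 * sum lower                    ≡⟨ cong (sum lower +_) (+-identityʳ (sum lower)) ⟩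
    sum lower + sum lower            ≡⟨ cong (sum lower +_) (sum-reindex-involution p (involutive M) lower) ⟩
    sum lower + sum (λ w → lower (p w)) ≡⟨ cong (sum lower +_) (sum-cong-≗ lower∘p≗upper) ⟩
    sum lower + sum upper            ≡⟨ ∑-distrib-+ lower upper ⟨
    sum (λ w → lower w + upper w)    ≡⟨ sum-cong-≗ lower+upper≗endpoint ⟩
    endpointsOfColour p              ∎
    where
    open ≡-Reasoning
    p : Fin m → Fin m
    p = partner M
    lower upper : Fin m → ℕ
    lower w = fromBool (⌊ w <? p w ⌋ ∧ P (colour c w (p w)))
    upper w = fromBool (⌊ p w <? w ⌋ ∧ P (colour c w (p w)))
    lower∘p≗upper : ∀ w → lower (p w) ≡ upper w
    lower∘p≗upper w = cong₂ (λ v k → fromBool (⌊ p w <? v ⌋ ∧ P k)) (involutive M w) (colour-partner c M w)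
    lower+upper≗endpoint : ∀ w → lower w + upper w ≡ fromBool (P (colour c w (p w)))
    lower+upper≗endpoint w = fromBool-<-∧-split w (p w) _ (≢-sym (fixpointFree M w))

partner-injective : ∀ {m} (M : PerfectMatching m) {v w : Fin m} → partner M v ≡ partner M w → v ≡ w
partner-injective M {v} {w} pv≡pw =
  trans (sym (involutive M v)) (trans (cong (partner M) pv≡pw) (involutive M w))

partner-flip : ∀ {m} (M : PerfectMatching m) {v w : Fin m} → partner M v ≡ w → v ≡ partner M w
partner-flip M {v} pv≡w = trans (sym (involutive M v)) (cong (partner M) pv≡w)

module Swap {m} (M : PerfectMatching m) (a b : Fin m) (b≢a : b ≢ a) (b≢pa : b ≢ partner M a) where

  p : Fin m → Fin m
  p = partner M

  q : Fin m → Fin m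
  q = S M a (p a) b (p b)

  pa≢a : p a ≢ a
  pa≢a = fixpointFree M a

  pb≢b : p b ≢ b
  pb≢b = fixpointFree M b

  pb≢a : p b ≢ a
  pb≢a pb≡a = b≢pa (partner-flip M pb≡a)

  pb≢pa : p b ≢ p a
  pb≢pa pb≡pa = b≢a (partner-injective M pb≡pa)

  private
    yes-refl : (u : Fin m) → ∃[ e ] (u ≟ u) ≡ yes e
    yes-refl u = dec-yes (u ≟ u) refl

  -- Each rewrite only exposes the next layer of the with-clauses of swapMap, so the
  -- diagonal test (p a ≟ p a) or (p b ≟ p b) may have to be rewritten a second time.
  q-a : q a ≡ b
  q-a rewrite proj₂ (yes-refl (p a)) | proj₂ (yes-refl (p b)) | proj₂ (yes-refl a) = refl

  q-pa : q (p a) ≡ p b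
  q-pa rewrite proj₂ (yes-refl (p a)) | proj₂ (yes-refl (p b))
             | dec-no (p a ≟ a) pa≢a | proj₂ (yes-refl (p a)) = refl

  q-b : q b ≡ a
  q-b rewrite proj₂ (yes-refl (p a)) | proj₂ (yes-refl (p b))
            | dec-no (b ≟ a) b≢a | dec-no (b ≟ p a) b≢pa | proj₂ (yes-refl b) = refl

  q-pb : q (p b) ≡ p a
  q-pb rewrite proj₂ (yes-refl (p a)) | proj₂ (yes-refl (p b))
             | dec-no (p b ≟ a) pb≢a | dec-no (p b ≟ p a) pb≢pa | dec-no (p b ≟ b) pb≢b
             | proj₂ (yes-refl (p b)) = refl

  q-other : ∀ w → w ≢ a → w ≢ p a → w ≢ b → w ≢ p b → q w ≡ p w
  q-other w w≢a w≢pa w≢b w≢pb rewrite proj₂ (yes-refl (p a)) | proj₂ (yes-refl (p b))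
    | dec-no (w ≟ a) w≢a | dec-no (w ≟ p a) w≢pa | dec-no (w ≟ b) w≢b | dec-no (w ≟ p b) w≢pb = refl

  q-involutive : ∀ w → q (q w) ≡ w
  q-involutive w with w ≟ a | w ≟ p a | w ≟ b | w ≟ p b
  ... | yes refl | _        | _        | _        rewrite q-a  = q-b
  ... | no _     | yes refl | _        | _        rewrite q-pa = q-pb
  ... | no _     | no _     | yes refl | _        rewrite q-b  = q-a
  ... | no _     | no _     | no _     | yes refl rewrite q-pb = q-pa
  ... | no w≢a   | no w≢pa  | no w≢b   | no w≢pb  rewrite q-other w w≢a w≢pa w≢b w≢pb =
    trans (q-other (p w) (w≢pa ∘ partner-flip M) (w≢a ∘ partner-injective M)
                         (w≢pb ∘ partner-flip M) (w≢b ∘ partner-injective M))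
          (involutive M w)

  q-fixpointFree : ∀ w → q w ≢ w
  q-fixpointFree w with w ≟ a | w ≟ p a | w ≟ b | w ≟ p b
  ... | yes refl | _        | _        | _        = b≢a ∘ trans (sym q-a)
  ... | no _     | yes refl | _        | _        = pb≢pa ∘ trans (sym q-pa)
  ... | no _     | no _     | yes refl | _        = b≢a ∘ sym ∘ trans (sym q-b)
  ... | no _     | no _     | no _     | yes refl = pb≢pa ∘ sym ∘ trans (sym q-pb)
  ... | no w≢a   | no w≢pa  | no w≢b   | no w≢pb  =
    fixpointFree M w ∘ trans (sym (q-other w w≢a w≢pa w≢b w≢pb))

  swapped : PerfectMatching m
  swapped = record { partner = q ; involutive = q-involutive ; fixpointFree = q-fixpointFree }

  module _ (c : Colouring m) (P : Colour → Bool) where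

    κ : Fin m → Fin m → ℕ
    κ v w = fromBool (P (colour c v w))

    endpointsOfColour-swapped :
      endpointsOfColour c P p + 2 * (κ a b + κ (p a) (p b))
        ≡ endpointsOfColour c P q + 2 * (κ a (p a) + κ b (p b))
    endpointsOfColour-swapped = begin
      endpointsOfColour c P p + 2 * (κ a b + κ (p a) (p b))  ≡⟨ cong (endpointsOfColour c P p +_) Σg ⟨
      endpointsOfColour c P p + listSum (List.map g ds)     ≡⟨ sum-exchange-on f g unique f≡g-off-ds ⟩
      endpointsOfColour c P q + listSum (List.map f ds)     ≡⟨ cong (endpointsOfColour c P q +_) Σf ⟩
      endpointsOfColour c P q + 2 * (κ a (p a) + κ b (p b))  ∎
      where
      open ≡-Reasoning
      f g : Fin m → ℕ
      f w = κ w (p w)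
      g w = κ w (q w)
      ds : List (Fin m)
      ds = a ∷ p a ∷ b ∷ p b ∷ []
      unique : Unique ds
      unique = (≢-sym pa≢a ∷ ≢-sym b≢a ∷ ≢-sym pb≢a ∷ [])
             ∷ (≢-sym b≢pa ∷ ≢-sym pb≢pa ∷ [])
             ∷ (≢-sym pb≢b ∷ [])
             ∷ [] ∷ []
      f≡g-off-ds : ∀ w → w ∉ ds → f w ≡ g w
      f≡g-off-ds w w∉ds = cong (κ w) (sym (q-other w (w∉ds ∘ here) (w∉ds ∘ there ∘ here)
                                                   (w∉ds ∘ there ∘ there ∘ here)
                                                   (w∉ds ∘ there ∘ there ∘ there ∘ here)))
      κ-sym : ∀ v w → κ v w ≡ κ w v
      κ-sym v w = cong (fromBool ∘ P) (symmetric c v w)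
      twice : ∀ x y → x + (y + (x + (y + 0))) ≡ 2 * (x + y)
      twice = solve-∀
      twice′ : ∀ x y → x + (x + (y + (y + 0))) ≡ 2 * (x + y)
      twice′ = solve-∀
      Σg : listSum (List.map g ds) ≡ 2 * (κ a b + κ (p a) (p b))
      Σg = trans (cong₂ _+_ (cong (κ a) q-a)
                 (cong₂ _+_ (cong (κ (p a)) q-pa)
                 (cong₂ _+_ (trans (cong (κ b) q-b) (κ-sym b a))
                 (cong (_+ 0) (trans (cong (κ (p b)) q-pb) (κ-sym (p b) (p a)))))))
                 (twice (κ a b) (κ (p a) (p b)))
      Σf : listSum (List.map f ds) ≡ 2 * (κ a (p a) + κ b (p b))
      Σf = trans (cong₂ (λ s t → κ a (p a) + (s + (κ b (p b) + (t + 0))))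
                        (cong (fromBool ∘ P) (colour-partner c M a)) (cong (fromBool ∘ P) (colour-partner c M b)))
                 (twice′ (κ a (p a)) (κ b (p b)))

    edgesOfColour-swapped :
      edgesOfColour c P p + (κ a b + κ (p a) (p b)) ≡ edgesOfColour c P q + (κ a (p a) + κ b (p b))
    edgesOfColour-swapped = *-cancelˡ-≡ (edgesOfColour c P p + added) (edgesOfColour c P q + removed) 2 (begin
      2 * (edgesOfColour c P p + added)        ≡⟨ *-distribˡ-+ 2 (edgesOfColour c P p) added ⟩
      2 * edgesOfColour c P p + 2 * added      ≡⟨ cong (_+ 2 * added) (handshake c P M) ⟩
      endpointsOfColour c P p + 2 * added      ≡⟨ endpointsOfColour-swapped ⟩
      endpointsOfColour c P q + 2 * removed    ≡⟨ cong (_+ 2 * removed) (handshake c P swapped) ⟨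
      2 * edgesOfColour c P q + 2 * removed    ≡⟨ *-distribˡ-+ 2 (edgesOfColour c P q) removed ⟨
      2 * (edgesOfColour c P q + removed)      ∎)
      where
      open ≡-Reasoning
      added removed : ℕ
      added   = κ a b + κ (p a) (p b)
      removed = κ a (p a) + κ b (p b)

  module _ (c : Colouring m)
           (a-red : colour c a (p a) ≡ red) (b-black : colour c b (p b) ≡ black)
           (ab-red : colour c a b ≡ red) (papb-red : colour c (p a) (p b) ≡ red) where

    edgesOfColour-swapped-black→red : (P : Colour → Bool) →
      edgesOfColour c P p + (fromBool (P red) + fromBool (P red))
        ≡ edgesOfColour c P q + (fromBool (P red) + fromBool (P black))
    edgesOfColour-swapped-black→red P =
      subst₂ (λ added removed → edgesOfColour c P p + added ≡ edgesOfColour c P q + removed)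
             (cong₂ _+_ (κ-≡ ab-red) (κ-≡ papb-red)) (cong₂ _+_ (κ-≡ a-red) (κ-≡ b-black))
             (edgesOfColour-swapped c P)
      where
      κ-≡ : ∀ {v w k} → colour c v w ≡ k → κ c P v w ≡ fromBool (P k)
      κ-≡ = cong (fromBool ∘ P)

    rM-swapped : rM c q ≡ rM c p + 1
    rM-swapped = +-cancelʳ-≡ 1 (rM c q) (rM c p + 1)
                   (trans (sym (edgesOfColour-swapped-black→red isRed)) (sym (+-assoc (rM c p) 1 1)))

    bM-swapped : bM c q + 1 ≡ bM c p
    bM-swapped = trans (sym (edgesOfColour-swapped-black→red isBlack)) (+-identityʳ (bM c p))

cross-indicator-< : ∀ k₁ k₂ k₃ k₄ →
  fromBool (isRed k₁ ∧ isBlack k₂ ∧ isBlack k₄) < fromBool (isRed k₁ ∧ isBlack k₂ ∧ isRed k₃) →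
  k₁ ≡ red × k₂ ≡ black × k₃ ≡ red × k₄ ≡ red
cross-indicator-< red   black red   red   _         = refl , refl , refl , refl
cross-indicator-< red   black red   black (s≤s ())
cross-indicator-< red   black black _     ()
cross-indicator-< red   red   _     _     ()
cross-indicator-< black _     _     _     ()

module _ {m} (c : Colouring m) (M : PerfectMatching m) where

  private
    p : Fin m → Fin m
    p = partner M

    crossing : (Colour → Bool) → Fin m → Fin m → Bool
    crossing P a b = inVR c M a ∧ inVB c M b ∧ P (colour c a b)

  redCross≡sum : redCross c M ≡ sum (λ a → sum (λ b → fromBool (crossing isRed a b)))
  redCross≡sum = count-allPairs (λ { (a , b) → crossing isRed a b })

  blackCross≡sum :
    blackCross c M ≡ sum (λ a → sum (λ b → fromBool (inVR c M a ∧ inVB c M b ∧ isBlack (colour c (p a) (p b)))))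
  blackCross≡sum = begin
    blackCross c M                              ≡⟨ count-allPairs (λ { (a , b) → crossing isBlack a b }) ⟩
    sum (λ a → sum (λ b → χ a b))               ≡⟨ sum-cong-≗ (λ a → reindex (χ a)) ⟩
    sum (λ a → sum (λ b → χ a (p b)))           ≡⟨ reindex (λ a → sum (λ b → χ a (p b))) ⟩
    sum (λ a → sum (λ b → χ (p a) (p b)))       ≡⟨ sum-cong-≗ (λ a → sum-cong-≗ (χ-partners a)) ⟩
    sum (λ a → sum (λ b → fromBool (inVR c M a ∧ inVB c M b ∧ isBlack (colour c (p a) (p b))))) ∎
    where
    open ≡-Reasoning
    χ : Fin m → Fin m → ℕ
    χ a b = fromBool (crossing isBlack a b)
    reindex : (f : Fin m → ℕ) → sum f ≡ sum (λ w → f (p w))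
    reindex = sum-reindex-involution p (involutive M)
    χ-partners : ∀ a b → χ (p a) (p b) ≡ fromBool (inVR c M a ∧ inVB c M b ∧ isBlack (colour c (p a) (p b)))
    χ-partners a b = cong₂ (λ x y → fromBool (x ∧ y ∧ isBlack (colour c (p a) (p b))))
                           (cong isRed (colour-partner c M a)) (cong isBlack (colour-partner c M b))

  blackCross<redCross⇒swappable : blackCross c M < redCross c M →
    ∃[ a ] ∃[ b ] (colour c a (p a) ≡ red × colour c b (p b) ≡ black
                  × colour c a b ≡ red × colour c (p a) (p b) ≡ red)
  blackCross<redCross⇒swappable black<red =
    let a , row-a< = sum<sum⇒∃< _ _ (subst₂ _<_ blackCross≡sum redCross≡sum black<red)
        b , entry< = sum<sum⇒∃< _ _ row-a<
    in a , b , cross-indicator-< (colour c a (p a)) (colour c b (p b)) (colour c a b) (colour c (p a) (p b)) entry<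

  edges-red+black : 2 * (rM c p + bM c p) ≡ m
  edges-red+black = begin
    2 * (rM c p + bM c p)                          ≡⟨ *-distribˡ-+ 2 (rM c p) (bM c p) ⟩
    2 * rM c p + 2 * bM c p                        ≡⟨ cong₂ _+_ (handshake c isRed M) (handshake c isBlack M) ⟩
    sum (endpoint isRed) + sum (endpoint isBlack)  ≡⟨ ∑-distrib-+ (endpoint isRed) (endpoint isBlack) ⟨
    sum (λ w → endpoint isRed w + endpoint isBlack w)
                                   ≡⟨ sum-cong-≗ (λ w → fromBool-isRed+isBlack (colour c w (p w))) ⟩
    sum {m} (const 1)                              ≡⟨ sum-const-1 m ⟩
    m                                              ∎
    where
    open ≡-Reasoning
    endpoint : (Colour → Bool) → Fin m → ℕ
    endpoint P w = fromBool (P (colour c w (p w)))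

swap-increasing-red : ∀ {m} (c : Colouring m) (M : PerfectMatching m) → blackCross c M < redCross c M →
  ∃[ u ] ∃[ v ] ∃[ x ] ∃[ y ]
    ((u , v) ∈M partner M × (x , y) ∈M partner M × ¬ (x ≡ u) × ¬ (x ≡ v)
    × rM c (S M u v x y) ≡ rM c (partner M) + 1
    × bM c (S M u v x y) + 1 ≡ bM c (partner M))
swap-increasing-red {m} c M black<red with blackCross<redCross⇒swappable c M black<red
... | a , b , a-red , b-black , ab-red , papb-red =
  a , partner M a , b , partner M b , refl , refl , b≢a , b≢pa ,
  rM-swapped c a-red b-black ab-red papb-red , bM-swapped c a-red b-black ab-red papb-red
  where
  matchingColour : Fin m → Colour
  matchingColour v = colour c v (partner M v)
  red≢black : red ≢ black
  red≢black ()
  b≢a : b ≢ a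
  b≢a b≡a = red≢black (trans (sym a-red) (trans (cong matchingColour (sym b≡a)) b-black))
  b≢pa : b ≢ partner M a
  b≢pa b≡pa = red≢black (trans (sym a-red)
                (trans (sym (colour-partner c M a)) (trans (cong matchingColour (sym b≡pa)) b-black)))
  open Swap M a b b≢a b≢pa

parity-step : ∀ n r b r′ b′ → r + b ≡ 2 * n → r < b → r′ ≡ r + 1 → b′ + 1 ≡ b →
  ∣ b′ - r′ ∣ ≡ ∣ b - r ∣ ∸ 2
parity-step n r b r′ b′ r+b≡2n r<b refl b′+1≡b with m≤n⇒∃[o]m+o≡n r<b
... | zero  , refl = contradiction (trans (sym r+b≡2n) (r+[1+r]≡1+2r r)) (even≢odd n r)
  where
  r+[1+r]≡1+2r : ∀ r → r + (suc r + 0) ≡ suc (2 * r)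
  r+[1+r]≡1+2r = solve-∀
... | suc d , refl = begin
  ∣ b′ - (r + 1) ∣            ≡⟨ cong ∣_- (r + 1) ∣ b′≡r+1+d ⟩
  ∣ r + 1 + d - (r + 1) ∣     ≡⟨ ∣-∣-comm (r + 1 + d) (r + 1) ⟩
  ∣ r + 1 - r + 1 + d ∣       ≡⟨ ∣m-m+n∣≡n (r + 1) d ⟩
  d                           ≡⟨ cong (_∸ 2) (∣m-m+n∣≡n r (2 + d)) ⟨
  ∣ r - r + (2 + d) ∣ ∸ 2     ≡⟨ cong (_∸ 2) (∣-∣-comm r (r + (2 + d))) ⟩
  ∣ r + (2 + d) - r ∣ ∸ 2     ≡⟨ cong (λ x → ∣ x - r ∣ ∸ 2) (r+[2+d]≡1+r+[1+d] r d) ⟩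
  ∣ suc r + suc d - r ∣ ∸ 2   ∎
  where
  open ≡-Reasoning
  r+[2+d]≡1+r+[1+d] : ∀ r d → r + (2 + d) ≡ suc r + suc d
  r+[2+d]≡1+r+[1+d] = solve-∀
  1+r+[1+d]≡r+1+d+1 : ∀ r d → suc r + suc d ≡ r + 1 + d + 1
  1+r+[1+d]≡r+1+d+1 = solve-∀
  b′≡r+1+d : b′ ≡ r + 1 + d
  b′≡r+1+d = +-cancelʳ-≡ 1 b′ (r + 1 + d) (trans b′+1≡b (1+r+[1+d]≡r+1+d+1 r d))

lemma3 : (n : ℕ) → 1 ≤ n → (c : Colouring (4 * n)) → (M : PerfectMatching (4 * n)) →
  (blackCross c M < redCross c M →
    ∃[ u ] ∃[ v ] ∃[ x ] ∃[ y ]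
      ((u , v) ∈M partner M × (x , y) ∈M partner M × ¬ (x ≡ u) × ¬ (x ≡ v)
      × rM c (S M u v x y) ≡ rM c (partner M) + 1
      × bM c (S M u v x y) + 1 ≡ bM c (partner M)))
  × (blackCross c M < redCross c M → rM c (partner M) < bM c (partner M) →
    ∃[ u ] ∃[ v ] ∃[ x ] ∃[ y ]
      ((u , v) ∈M partner M × (x , y) ∈M partner M × ¬ (x ≡ u) × ¬ (x ≡ v)
      × rM c (S M u v x y) ≡ rM c (partner M) + 1
      × bM c (S M u v x y) + 1 ≡ bM c (partner M)
      × ∣ bM c (S M u v x y) - rM c (S M u v x y) ∣ ≡ ∣ bM c (partner M) - rM c (partner M) ∣ ∸ 2))
lemma3 n _ c M = swap-increasing-red c M , λ black<red r<b →
  let u , v , x , y , uv∈M , xy∈M , x≢u , x≢v , r′≡r+1 , b′+1≡b = swap-increasing-red c M black<red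
  in u , v , x , y , uv∈M , xy∈M , x≢u , x≢v , r′≡r+1 , b′+1≡b ,
     parity-step n _ _ _ _ r+b≡2n r<b r′≡r+1 b′+1≡b
  where
  r+b≡2n : rM c (partner M) + bM c (partner M) ≡ 2 * n
  r+b≡2n = *-cancelˡ-≡ _ _ 2 (trans (edges-red+black c M) (*-assoc 2 2 n))
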